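{- The fragment $\mathcal{L}_{\Diamond_L\langle-\rangle_1}$ does not have the finite model property: there is a formula of this fragment that is satisfiable at a singleton evaluation sequence, but only in models with infinitely many worlds.
   Context: Fix a countable set $\mathbf{P}$ of atoms. The language $\mathcal{L}$ of SLL is $\varphi::=p\mid\neg\varphi\mid(\varphi\land\varphi)\mid\Diamond_L\varphi\mid\langle-\rangle_1\varphi\mid\langle-\rangle_2\varphi\mid\langle+\rangle\varphi$, where $\Diamond_L$ is the learner-move modality (drawn as a black diamond in the paper); $\mathcal{L}_{\Diamond_L\langle-\rangle_1}$ is the fragment whose only modalities are $\Diamond_L$ and $\langle-\rangle_1$. A model is $\mathcal{M}=\langle W,R_1,R_2,V\rangle$ with $W\neq\emptyset$, $R_1,R_2\subseteq W^2$, $V:\mathbf{P}\to2^W$. For a finite non-empty sequence $S=\langle w_0,\dots,w_n\rangle$: $e(S)=w_n$; $Set(S)=\{\langle w_i,w_{i+1}\rangle\mid i<n\}$ ($\emptyset$ if singleton); for $\langle w_i,w_{i+1}\rangle\in Set(S)$, $S|_{\langle w_i,w_{i+1}\rangle}=\langle w_0,\dots,w_u\rangle$ with $u$ least such that $\langle w_u,w_{u+1}\rangle=\langle w_i,w_{i+1}\rangle$; $S;v$ is $S$ extended by $v$. A pointed model $\langle\mathcal{M},S\rangle$ requires $Set(S)\subseteq R_1$. $\mathcal{M}\ominus\langle v,v'\rangle$ removes $\langle v,v'\rangle$ from $R_1$. Semantics: $\mathcal{M},S\models p$ iff $e(S)\in V(p)$; Booleans as usual; $\Diamond_L\varphi$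 iff there is $v$ with $R_1e(S)v$ and $\mathcal{M},S;v\models\varphi$; $\langle-\rangle_1\varphi$ iff there is $\langle v,v'\rangle\in Set(S)\setminus R_2$ with $\mathcal{M}\ominus\langle v,v'\rangle,S|_{\langle v,v'\rangle}\models\varphi$. -}

module Defs where

open import Data.Nat using (ℕ)
open import Data.Fin using (Fin)
open import Data.Empty using (⊥)
open import Data.Product using (Σ; ∃; _×_; _,_)
open import Data.Sum using (_⊎_)
open import Data.List using (List; []; _∷_; _++_)
open import Data.List.NonEmpty using (List⁺; _∷_; head; toList; _∷⁺_)
open import Relation.Nullary using (¬_)
open import Relation.Binary.PropositionalEquality using (_≡_)
open import Function.Bundles using (_↔_)

Atom : Set
Atom = ℕ

data Form : Set where
  atom   : Atom → Form
  ¬'_    : Form → Form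
  _∧'_   : Form → Form → Form
  ◆L     : Form → Form
  ⟨-⟩₁   : Form → Form

record Model : Set₁ where
  field
    W  : Set
    R₁ : W → W → Set
    R₂ : W → W → Set
    V  : Atom → W → Set
open Model public

_⊖_ : (M : Model) → W M × W M → Model
M ⊖ (v , v') = record
  { W  = W M
  ; R₁ = λ x y → R₁ M x y × ¬ (x ≡ v × y ≡ v')
  ; R₂ = R₂ M
  ; V  = V M }

-- Evaluation sequences ⟨w₀,…,wₙ⟩ are stored REVERSED as a non-empty list
-- wₙ ∷ … ∷ w₀, so that e(S) = head S and S;v = v ∷⁺ S.
Seq : Set → Set
Seq A = List⁺ A

-- Edge v v' ws : ⟨v,v'⟩ ∈ Set(S) where ws = toList S (reversed order).
Edge : {A : Set} → A → A → List A → Set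
Edge v v' []           = ⊥
Edge v v' (x ∷ [])     = ⊥
Edge v v' (x ∷ y ∷ ys) = (y ≡ v × x ≡ v') ⊎ Edge v v' (y ∷ ys)

-- Satisfaction M , S ⊨ φ.
-- ⟨-⟩₁: S (reversed) splits as  top ++ v' ∷ P  with head P = v, i.e. P is the
-- prefix ⟨w₀,…,w_u⟩ with w_u = v, w_{u+1} = v'; the first-occurrence condition is
-- that ⟨v,v'⟩ ∉ Set(P).  So P = S|_{⟨v,v'⟩} and ⟨v,v'⟩ ∈ Set(S).
_,_⊨_ : (M : Model) → Seq (W M) → Form → Set
M , S ⊨ atom p   = V M p (head S)
M , S ⊨ (¬' φ)   = ¬ (M , S ⊨ φ)
M , S ⊨ (φ ∧' ψ) = (M , S ⊨ φ) × (M , S ⊨ ψ)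
M , S ⊨ ◆L φ     = Σ (W M) λ v → R₁ M (head S) v × (M , v ∷⁺ S ⊨ φ)
M , S ⊨ ⟨-⟩₁ φ   =
  Σ (W M) λ v → Σ (W M) λ v' → Σ (Seq (W M)) λ P → Σ (List (W M)) λ top →
    (toList S ≡ top ++ (v' ∷ toList P)) × (head P ≡ v) × ¬ (R₂ M v v')
    × ¬ (Edge v v' (toList P)) × ((M ⊖ (v , v')) , P ⊨ φ)

Finite : Set → Set
Finite A = Σ ℕ λ n → A ↔ Fin n

-- Let A be the set of p-successors of the root w. The formula φ₀ makes w a ¬p-world
-- with A non-empty and gives every p-successor, along p-paths of length at most 3, an
-- exit (a ¬p-successor). A dead end (a p-successor without exit) can then only arise
-- after ⟨-⟩₁ has removed the exit of its witness from the evaluation sequence; the two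
-- ⟨-⟩₁-axioms of φ₀ exploit this to force R₁ to be a serial strict order on A. A serial
-- strict order on a non-empty set has ascending chains of every length, so the set of
-- worlds is infinite by pigeonhole. Satisfaction being constructive, these consequences
-- are derived under double negation, which is enough to refute finiteness.
-- Conversely, ℕ with root 0 as common exit and < on the positive worlds satisfies φ₀.
module Submission where

open import Defs
open import Data.Product using (Σ; ∃-syntax; _×_; _,_; proj₁; proj₂)
open import Data.Sum using (_⊎_; inj₁; inj₂)
open import Data.List using (List; []; _∷_; _++_)
open import Data.List.NonEmpty using (_∷_; head; toList; _∷⁺_)
open import Data.Nat using (ℕ; zero; suc; _<_; s≤s)
open import Data.Nat.Properties using (≤-refl; <-trans; <-irrefl; n<1+n; 1+n≢n; suc-injective)
open import Data.Fin using (zero; suc)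
  renaming (_<_ to _<ᶠ_)
open import Data.Fin.Properties using (pigeonhole)
open import Data.Vec.Functional using (Vector)
open import Data.Empty using (⊥; ⊥-elim)
open import Data.Unit using (⊤; tt)
open import Effect.Monad using (RawMonad)
open import Level using (0ℓ)
open import Function using (_∘_)
open import Function.Bundles using (Injection)
open import Function.Properties.Inverse using (↔⇒↣)
open import Relation.Nullary using (¬_)
open import Relation.Nullary.Negation using (¬¬-Monad; ¬¬-map)
open import Relation.Binary.PropositionalEquality using (_≡_; _≢_; refl; sym; subst)

open RawMonad (¬¬-Monad {a = 0ℓ}) using (_>>=_; return)

module _ {A : Set} (R : A → A → Set) (I : A → Set)
  (irreflexive : ∀ {a} → I a → ¬ R a a)
  (transitive : ∀ {a b c} → I a → I b → I c → R a b → R b c → ¬ ¬ R a c)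
  (serial : ∀ {a} → I a → ¬ ¬ (∃[ b ] I b × R a b))
  where

  record AscentAbove (a : A) (k : ℕ) : Set where
    field
      point     : Vector A k
      inside    : ∀ i → I (point i)
      above     : ∀ i → ¬ ¬ R a (point i)
      ascending : ∀ {i j} → i <ᶠ j → ¬ ¬ R (point i) (point j)

  prependAscent : ∀ {a b k} → I a → I b → R a b → AscentAbove b k → AscentAbove a (suc k)
  prependAscent {a} {b} Ia Ib Rab asc = record
    { point = point′ ; inside = inside′ ; above = above′ ; ascending = ascending′ }
    where
    open AscentAbove asc
    point′ : Vector A (suc _)
    point′ zero    = b
    point′ (suc i) = point i
    inside′ : ∀ i → I (point′ i)
    inside′ zero    = Ib
    inside′ (suc i) = inside i
    above′ : ∀ i → ¬ ¬ R a (point′ i)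
    above′ zero    = return Rab
    above′ (suc i) = above i >>= transitive Ia Ib (inside i) Rab
    ascending′ : ∀ {i j} → i <ᶠ j → ¬ ¬ R (point′ i) (point′ j)
    ascending′ {zero}  {suc j} _         = above j
    ascending′ {suc i} {suc j} (s≤s i<j) = ascending i<j

  ascentAbove : ∀ k {a} → I a → ¬ ¬ AscentAbove a k
  ascentAbove zero    _  = return (record
    { point = λ () ; inside = λ () ; above = λ () ; ascending = λ { {()} } })
  ascentAbove (suc k) Ia = do
    b , Ib , Rab ← serial Ia
    asc ← ascentAbove k Ib
    return (prependAscent Ia Ib Rab asc)

  inhabited⇒¬finite : ∀ {a} → I a → ¬ Finite A
  inhabited⇒¬finite Ia (n , A↔Fin) = ascentAbove (suc n) Ia λ asc →
    let open AscentAbove asc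
        open Injection (↔⇒↣ A↔Fin) using (to; injective)
        (i , j , i<j , same) = pigeonhole (n<1+n n) (to ∘ point)
    in ascending i<j (irreflexive (inside i) ∘ subst (R (point i)) (sym (injective same)))

p : Form
p = atom 0

infix 30 □_ □ᵖ_

□_ : Form → Form
□ φ = ¬' ◆L (¬' φ)

□ᵖ_ : Form → Form
□ᵖ φ = ¬' ◆L (p ∧' (¬' φ))

exit : Form
exit = ◆L (¬' p)

exitsAlong : ℕ → Form
exitsAlong zero    = □ᵖ exit
exitsAlong (suc n) = □ᵖ (exit ∧' exitsAlong n)

deadEnd : Form
deadEnd = ◆L (p ∧' □ p)

shortcut : Form
shortcut = ◆L (⟨-⟩₁ (⟨-⟩₁ (p ∧' deadEnd)))

transitivityAxiom : Form
transitivityAxiom = □ᵖ □ᵖ □ᵖ shortcut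

detour : Form
detour = ◆L (p ∧' ◆L (⟨-⟩₁ (⟨-⟩₁ ((¬' p) ∧' deadEnd))))

serialityAxiom : Form
serialityAxiom = □ᵖ detour

φ₀ : Form
φ₀ = (¬' p) ∧' (◆L p ∧' (exitsAlong 2 ∧' (serialityAxiom ∧' transitivityAxiom)))

P : (M : Model) → W M → Set
P M = V M 0

-- Restriction xs v v' ys: v ∷ ys is xs|⟨v,v'⟩ (sequences reversed; the
-- first-occurrence condition is not recorded).
data Restriction {A : Set} : List A → A → A → List A → Set where
  here  : ∀ {v v' ys} → Restriction (v' ∷ v ∷ ys) v v' ys
  there : ∀ {x xs v v' ys} → Restriction xs v v' ys → Restriction (x ∷ xs) v v' ys

++-restriction : ∀ {A : Set} (top : List A) {v v' ys} → Restriction (top ++ v' ∷ v ∷ ys) v v' ys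
++-restriction []        = here
++-restriction (_ ∷ top) = there (++-restriction top)

record TwoRemovals (M : Model) (S : Seq (W M)) (φ : Form) : Set where
  constructor removals
  field
    {v₁ v₁' v₂ v₂'} : W M
    {ys₁ ys₂}       : List (W M)
    first  : Restriction (toList S) v₁ v₁' ys₁
    second : Restriction (v₁ ∷ ys₁) v₂ v₂' ys₂
    holds  : ((M ⊖ (v₁ , v₁')) ⊖ (v₂ , v₂')) , v₂ ∷ ys₂ ⊨ φ

⟨-⟩₁²-elim : ∀ {M S φ} → M , S ⊨ ⟨-⟩₁ (⟨-⟩₁ φ) → TwoRemovals M S φ
⟨-⟩₁²-elim (_ , _ , _ ∷ _ , top₁ , S≡ , refl , _ , _ ,
            (_ , _ , _ ∷ _ , top₂ , P≡ , refl , _ , _ , holds)) =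
  removals (subst (λ xs → Restriction xs _ _ _) (sym S≡) (++-restriction top₁))
           (subst (λ xs → Restriction xs _ _ _) (sym P≡) (++-restriction top₂))
           holds

Exit : (M : Model) → W M → Set
Exit M x = ∃[ z ] R₁ M x z × ¬ P M z

ExitsAfter : (M : Model) → W M → Set
ExitsAfter M y = ∀ {x} → R₁ M y x → P M x → ¬ ¬ Exit M x

DeadEnd : (M : Model) → W M → Set
DeadEnd M y = ∃[ x ] R₁ M y x × P M x × ¬ Exit M x

module _ {M : Model} {S : Seq (W M)} where

  □ᵖ-elim : ∀ φ {v} → M , S ⊨ □ᵖ φ → R₁ M (head S) v → P M v → ¬ ¬ (M , v ∷⁺ S ⊨ φ)
  □ᵖ-elim _ □ᵖφ Rv pv ¬φ = □ᵖφ (_ , Rv , pv , ¬φ)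

  exitsAlong⇒ExitsAfter : ∀ n → M , S ⊨ exitsAlong n → ExitsAfter M (head S)
  exitsAlong⇒ExitsAfter zero    h Rx px = □ᵖ-elim exit h Rx px
  exitsAlong⇒ExitsAfter (suc n) h Rx px =
    ¬¬-map proj₁ (□ᵖ-elim (exit ∧' exitsAlong n) h Rx px)

  exitsAlong-step : ∀ {n v} → M , S ⊨ exitsAlong (suc n) → R₁ M (head S) v → P M v →
    ¬ ¬ (M , v ∷⁺ S ⊨ exitsAlong n)
  exitsAlong-step {n} h Rv pv =
    ¬¬-map proj₂ (□ᵖ-elim (exit ∧' exitsAlong n) h Rv pv)

deadEnd-after-removals : ∀ {M} (v₁ v₁' v₂ v₂' : W M) {y} →
  DeadEnd ((M ⊖ (v₁ , v₁')) ⊖ (v₂ , v₂')) y → ExitsAfter M y →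
  ¬ ¬ (∃[ x ] R₁ ((M ⊖ (v₁ , v₁')) ⊖ (v₂ , v₂')) y x
              × (x ≡ v₁ × ¬ P M v₁' ⊎ x ≡ v₂ × ¬ P M v₂'))
deadEnd-after-removals _ _ _ _ (x , R′x , px , noExit) exits k =
  exits (proj₁ (proj₁ R′x)) px λ (z , Rxz , ¬pz) →
    noExit (z , ((Rxz , λ { (refl , refl) → k (x , R′x , inj₁ (refl , ¬pz)) })
                      , λ { (refl , refl) → k (x , R′x , inj₂ (refl , ¬pz)) }) , ¬pz)

module _ {M : Model} {w a b : W M} (¬pw : ¬ P M w) (pa : P M a) (pb : P M b) where

  -- Of the possible pairs of removed steps only ⟨c,e⟩ followed by ⟨a,b⟩ is consistent.
  shortcut-from-removals : ∀ {c e} → P M c → ExitsAfter M a → ExitsAfter M b →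
    TwoRemovals M (e ∷ c ∷ b ∷ a ∷ w ∷ []) (p ∧' deadEnd) → ¬ ¬ (R₁ M a c × b ≢ c)
  shortcut-from-removals {c} {e} pc _ Eb (removals here here (_ , dead)) =
    deadEnd-after-removals {M} c e b c dead Eb >>= λ where
      (_ , (_ , x≢c) , inj₁ (refl , _)) → ⊥-elim (x≢c (refl , refl))
      (_ , _ , inj₂ (_ , ¬pc))           → ⊥-elim (¬pc pc)
  shortcut-from-removals {c} {e} pc Ea _ (removals here (there here) (_ , dead)) =
    deadEnd-after-removals {M} c e a b dead Ea >>= λ where
      (_ , ((Rac , _) , c≢b) , inj₁ (refl , _)) → return (Rac , λ b≡c → c≢b (refl , sym b≡c))
      (_ , _ , inj₂ (_ , ¬pb))                   → ⊥-elim (¬pb pb)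
  shortcut-from-removals {c} pc Ea _ (removals (there here) here (_ , dead)) =
    deadEnd-after-removals {M} b c a b dead Ea >>= λ where
      (_ , _ , inj₁ (_ , ¬pc)) → ⊥-elim (¬pc pc)
      (_ , _ , inj₂ (_ , ¬pb)) → ⊥-elim (¬pb pb)
  shortcut-from-removals _ _ _ (removals here (there (there here)) (pw , _)) = ⊥-elim (¬pw pw)
  shortcut-from-removals _ _ _ (removals (there here) (there here) (pw , _)) = ⊥-elim (¬pw pw)
  shortcut-from-removals _ _ _ (removals (there (there here)) here (pw , _)) = ⊥-elim (¬pw pw)
  shortcut-from-removals _ _ _ (removals here (there (there (there (there ())))) _)
  shortcut-from-removals _ _ _ (removals (there here) (there (there (there ()))) _)
  shortcut-from-removals _ _ _ (removals (there (there here)) (there (there ())) _)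
  shortcut-from-removals _ _ _ (removals (there (there (there here))) (there ()) _)
  shortcut-from-removals _ _ _ (removals (there (there (there (there (there ()))))) _ _)

  successor-from-removals : ∀ {e} → ExitsAfter M w →
    TwoRemovals M (e ∷ b ∷ a ∷ w ∷ []) ((¬' p) ∧' deadEnd) → ¬ ¬ R₁ M w b
  successor-from-removals _ (removals here here (¬pa , _)) = ⊥-elim (¬pa pa)
  successor-from-removals {e} Ew (removals here (there here) (_ , dead)) =
    deadEnd-after-removals {M} b e w a dead Ew >>= λ where
      (_ , ((Rwb , _) , _) , inj₁ (refl , _)) → return Rwb
      (_ , _ , inj₂ (_ , ¬pa))                 → ⊥-elim (¬pa pa)
  successor-from-removals Ew (removals (there here) here (_ , dead)) =
    deadEnd-after-removals {M} a b w a dead Ew >>= λ where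
      (_ , _ , inj₁ (_ , ¬pb)) → ⊥-elim (¬pb pb)
      (_ , _ , inj₂ (_ , ¬pa)) → ⊥-elim (¬pa pa)
  successor-from-removals _ (removals here (there (there (there ()))) _)
  successor-from-removals _ (removals (there here) (there (there ())) _)
  successor-from-removals _ (removals (there (there here)) (there ()) _)
  successor-from-removals _ (removals (there (there (there (there ())))) _ _)

PSuccessor : (M : Model) → W M → W M → Set
PSuccessor M w x = R₁ M w x × P M x

module AtRoot {M : Model} {w : W M} (¬pw : ¬ P M w) (exits : M , w ∷ [] ⊨ exitsAlong 2) where

  exitsAfter-root : ExitsAfter M w
  exitsAfter-root = exitsAlong⇒ExitsAfter {M} {w ∷ []} 2 exits

  exitsAfter-depth₁ : ∀ {a} → PSuccessor M w a → ¬ ¬ ExitsAfter M a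
  exitsAfter-depth₁ (Rwa , pa) =
    ¬¬-map (exitsAlong⇒ExitsAfter {M} {_ ∷ w ∷ []} 1)
           (exitsAlong-step {M} {w ∷ []} {1} exits Rwa pa)

  exitsAfter-depth₂ : ∀ {a b} → PSuccessor M w a → R₁ M a b → P M b → ¬ ¬ ExitsAfter M b
  exitsAfter-depth₂ {a} (Rwa , pa) Rab pb = do
    exits₁ ← exitsAlong-step {M} {w ∷ []} {1} exits Rwa pa
    ¬¬-map (exitsAlong⇒ExitsAfter {M} {_ ∷ a ∷ w ∷ []} 0)
           (exitsAlong-step {M} {a ∷ w ∷ []} {0} exits₁ Rab pb)

  pSuccessors-strictly-transitive : M , w ∷ [] ⊨ transitivityAxiom → ∀ {a b c} → PSuccessor M w a →
    R₁ M a b → P M b → R₁ M b c → P M c → ¬ ¬ (R₁ M a c × b ≢ c)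
  pSuccessors-strictly-transitive trans {a} {b} (Rwa , pa) Rab pb Rbc pc = do
    trans₁ ← □ᵖ-elim {M} {w ∷ []} (□ᵖ □ᵖ shortcut) trans Rwa pa
    trans₂ ← □ᵖ-elim {M} {a ∷ w ∷ []} (□ᵖ shortcut) trans₁ Rab pb
    _ , _ , removed ← □ᵖ-elim {M} {b ∷ a ∷ w ∷ []} shortcut trans₂ Rbc pc
    Ea ← exitsAfter-depth₁ (Rwa , pa)
    Eb ← exitsAfter-depth₂ (Rwa , pa) Rab pb
    shortcut-from-removals {M} ¬pw pa pb pc Ea Eb (⟨-⟩₁²-elim removed)

  pSuccessors-serial : M , w ∷ [] ⊨ serialityAxiom → ∀ {a} → PSuccessor M w a →
    ¬ ¬ (∃[ b ] PSuccessor M w b × R₁ M a b)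
  pSuccessors-serial ser (Rwa , pa) = do
    b , Rab , pb , _ , _ , removed ← □ᵖ-elim {M} {w ∷ []} detour ser Rwa pa
    Rwb ← successor-from-removals {M} ¬pw pa pb exitsAfter-root (⟨-⟩₁²-elim removed)
    return (b , (Rwb , pb) , Rab)

  pSuccessors-irreflexive : M , w ∷ [] ⊨ transitivityAxiom → ∀ {a} → PSuccessor M w a → ¬ R₁ M a a
  pSuccessors-irreflexive trans A∋a@(_ , pa) Raa =
    pSuccessors-strictly-transitive trans A∋a Raa pa Raa pa λ (_ , a≢a) → a≢a refl

  pSuccessors-transitive : M , w ∷ [] ⊨ transitivityAxiom → ∀ {a b c} → PSuccessor M w a →
    PSuccessor M w b → PSuccessor M w c → R₁ M a b → R₁ M b c → ¬ ¬ R₁ M a c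
  pSuccessors-transitive trans A∋a (_ , pb) (_ , pc) Rab Rbc =
    ¬¬-map proj₁ (pSuccessors-strictly-transitive trans A∋a Rab pb Rbc pc)

_↝_ : ℕ → ℕ → Set
zero  ↝ zero  = ⊥
zero  ↝ suc _ = ⊤
suc _ ↝ zero  = ⊤
suc i ↝ suc j = i < j

positive : Atom → ℕ → Set
positive _ zero    = ⊥
positive _ (suc _) = ⊤

rootedChain : Model
rootedChain = record { W = ℕ ; R₁ = _↝_ ; R₂ = λ _ _ → ⊥ ; V = positive }

exitsAlong-holds : ∀ n {S} → rootedChain , S ⊨ exitsAlong n
exitsAlong-holds zero    (suc _ , _ , _ , noExit) = noExit (zero , tt , λ ())
exitsAlong-holds (suc n) (suc _ , _ , _ , noExit) = noExit ((zero , tt , λ ()) , exitsAlong-holds n)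

detour-holds : ∀ i → rootedChain , suc i ∷ 0 ∷ [] ⊨ detour
detour-holds i = suc (suc i) , ≤-refl , tt , 0 , tt ,
  (_ , _ , (suc (suc i) ∷ suc i ∷ 0 ∷ []) , [] , refl , refl , (λ ()) , fresh₁ ,
   (_ , _ , (0 ∷ []) , (suc (suc i) ∷ []) , refl , refl , (λ ()) , (λ ()) , (λ ()) , dead))
  where
  fresh₁ : ¬ Edge (suc (suc i)) 0 (suc (suc i) ∷ suc i ∷ 0 ∷ [])
  fresh₁ (inj₁ (_ , ()))
  fresh₁ (inj₂ (inj₁ (() , _)))
  dead : DeadEnd ((rootedChain ⊖ (suc (suc i) , 0)) ⊖ (0 , suc i)) 0
  dead = suc (suc i) , ((tt , λ { (() , _) }) ,
                         λ { (_ , ssi≡si) → 1+n≢n (suc-injective ssi≡si) }) , tt ,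
    λ { (zero , ((_ , kept) , _) , _) → kept (refl , refl) ; (suc _ , _ , ¬p) → ¬p tt }

shortcut-holds : ∀ {i j k} → i < j → j < k →
  rootedChain , suc k ∷ suc j ∷ suc i ∷ 0 ∷ [] ⊨ shortcut
shortcut-holds {i} {j} {k} i<j j<k = 0 , tt ,
  (_ , _ , (suc k ∷ suc j ∷ suc i ∷ 0 ∷ []) , [] , refl , refl , (λ ()) , fresh₁ ,
   (_ , _ , (suc i ∷ 0 ∷ []) , (suc k ∷ []) , refl , refl , (λ ()) , fresh₂ , tt , dead))
  where
  fresh₁ : ¬ Edge (suc k) 0 (suc k ∷ suc j ∷ suc i ∷ 0 ∷ [])
  fresh₁ (inj₁ (_ , ()))
  fresh₁ (inj₂ (inj₁ (_ , ())))
  fresh₁ (inj₂ (inj₂ (inj₁ (() , _))))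
  fresh₂ : ¬ Edge (suc i) (suc j) (suc i ∷ 0 ∷ [])
  fresh₂ (inj₁ (() , _))
  dead : DeadEnd ((rootedChain ⊖ (suc k , 0)) ⊖ (suc i , suc j)) (suc i)
  dead = suc k , ((<-trans i<j j<k , λ { (_ , ()) }) ,
                     λ { (_ , sk≡sj) → <-irrefl (sym (suc-injective sk≡sj)) j<k }) , tt ,
    λ { (zero , ((_ , kept) , _) , _) → kept (refl , refl) ; (suc _ , _ , ¬p) → ¬p tt }

rootedChain⊨φ₀ : rootedChain , 0 ∷ [] ⊨ φ₀
rootedChain⊨φ₀ = (λ ()) , (1 , tt , tt) , exitsAlong-holds 2 {0 ∷ []} , seriality , transitivity
  where
  seriality : rootedChain , 0 ∷ [] ⊨ serialityAxiom
  seriality (suc i , _ , _ , ¬detour) = ¬detour (detour-holds i)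
  transitivity : rootedChain , 0 ∷ [] ⊨ transitivityAxiom
  transitivity (suc i , _ , _ , ¬all) = ¬all λ where
    (suc j , i<j , _ , ¬all′) → ¬all′ λ where
      (suc k , j<k , _ , ¬shortcut) → ¬shortcut (shortcut-holds i<j j<k)

theorem7 : Σ Form λ φ →
    (Σ Model λ M → Σ (W M) λ w → M , (w ∷ []) ⊨ φ)
    × ((M : Model) (w : W M) → M , (w ∷ []) ⊨ φ → ¬ Finite (W M))
theorem7 = φ₀ , (rootedChain , 0 , rootedChain⊨φ₀) , λ where
  M w (¬pw , (_ , Rwa , pa) , exits , ser , trans) →
    let open AtRoot {M} {w} ¬pw exits in
    inhabited⇒¬finite (R₁ M) (PSuccessor M w)
      (pSuccessors-irreflexive trans) (pSuccessors-transitive trans) (pSuccessors-serial ser) (Rwa , pa)
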